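{- Let $h_1,\dots,h_k$ be positive integers, let $m\in[k]$, and let $a,b\geq 0$ be integers with $h_m-a\geq 1$. Let $P_1=(h_1,\dots,h_{m-1},h_m-a,h_{m+1},\dots,h_k)$ and $P_2=(h_1,\dots,h_{m-1},h_m+b,h_{m+1},\dots,h_k)$ (parts not required to be in non-increasing order). If an $\mathrm{ROS}(P_1)$ and an $\mathrm{ROS}(P_2)$ exist, then an $\mathrm{ROS}(h_1\dots h_k)$ exists.
   Context: Given a sequence $P=(p_1,\dots,p_k)$ of positive integers, an $\mathrm{ROS}(P)$ is an assignment of a non-negative rational number $O(i,j,\ell)$ to every multiset $\{i,j,\ell\}$ of elements of $[k]=\{1,\dots,k\}$ (invariant under permuting $i,j,\ell$) such that $\sum_{\ell\in[k]}O(i,j,\ell)=p_ip_j$ for all $i,j\in[k]$, and $O(i,i,i)=p_i^2$ and $O(i,i,j)=0$ for all $i\neq j$. -}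

module Defs where

open import Data.Nat as ℕ using (ℕ; suc)
open import Data.Fin using (Fin)
import Data.Integer as ℤ
open import Data.Rational as ℚ using (ℚ; 0ℚ; _≤_; _+_; _*_)
open import Data.Product using (∃)
open import Data.Vec.Functional using (foldr)
open import Relation.Nullary using (¬_)
open import Relation.Binary.PropositionalEquality using (_≡_)

Σℚ : ∀ {k} → (Fin k → ℚ) → ℚ
Σℚ = foldr _+_ 0ℚ

ℕ→ℚ : ℕ → ℚ
ℕ→ℚ n = ℤ.+ n ℚ./ 1

-- O is an assignment to multisets {i,j,l}, represented as a function on
-- ordered triples that is invariant under all permutations
-- (transposition of the first two and of the last two arguments generate S₃).
record IsROS {k : ℕ} (P : Fin k → ℕ) (O : Fin k → Fin k → Fin k → ℚ) : Set where
  field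
    nonneg  : ∀ i j l → 0ℚ ≤ O i j l
    sym₁₂   : ∀ i j l → O i j l ≡ O j i l
    sym₂₃   : ∀ i j l → O i j l ≡ O i l j
    rowSum  : ∀ i j → Σℚ (λ l → O i j l) ≡ ℕ→ℚ (P i ℕ.* P j)
    diag    : ∀ i → O i i i ≡ ℕ→ℚ (P i ℕ.* P i)
    offDiag : ∀ i j → ¬ (i ≡ j) → O i i j ≡ 0ℚ

HasROS : ∀ {k} → (Fin k → ℕ) → Set
HasROS {k} P = ∃ (IsROS {k} P)

Positive : ∀ {k} → (Fin k → ℕ) → Set
Positive {k} P = ∀ i → 1 ℕ.≤ P i

module Submission where

-- Mix the two given solutions: O = α O₁ + β O₂ with α + β = 1 and α a = β b, so that the
-- parts of P₁ and P₂ average to h.  For i ≠ j one of them, say j, differs from m, so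
-- P₁(j) = P₂(j) = h(j) and the (i,j) row sum α P₁(i)h(j) + β P₂(i)h(j) equals h(i)h(j).
-- Only the diagonal is wrong (O(m,m,m) = h(m)² + α a² + β b²); resetting every O(i,i,i)
-- to h(i)² repairs it, since O(i,i,l) = 0 for l ≠ i makes that entry the whole (i,i) row sum.

open import Defs
open import Data.Fin using (Fin)
open import Data.Vec.Functional using (updateAt)

-- A separate module, so that ℚ's _+_ and _≤_ do not clash with ℕ's in the statement below.
module MixingROS where
  open import Data.Nat as ℕ using (ℕ; zero; suc; _∸_)
  open import Data.Nat.Properties using (*-comm; m∸n+n≡m)
  import Data.Integer as ℤ
  import Data.Integer.Properties as ℤ
  open import Data.Fin using (_≟_; punchIn)
  open import Data.Fin.Properties using (punchInᵢ≢i)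
  open import Data.Rational using (ℚ; 0ℚ; 1ℚ; _+_; _*_; _≤_; 1/_; toℚᵘ)
  import Data.Rational as ℚ
  open import Data.Rational.Properties as ℚ using (+-*-commutativeRing)
  import Data.Rational.Unnormalised as ℚᵘ
  import Data.Rational.Unnormalised.Properties as ℚᵘ
  open import Data.Rational.Solver using (module +-*-Solver)
  open import Algebra.Bundles using (CommutativeRing)
  open import Algebra.Properties.Semiring.Sum (CommutativeRing.semiring +-*-commutativeRing)
    using (sum-cong-≗; ∑-distrib-+; *-distribˡ-sum; sum-remove; sum-replicate-zero)
  open import Data.Vec.Functional.Properties using (updateAt-updates; updateAt-minimal)
  open import Data.Product using (_×_; _,_; proj₁; proj₂)
  open import Function using (_∘_)
  open import Relation.Nullary using (¬_; Dec; yes; no; contradiction; _×-dec_)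
  open import Relation.Binary.PropositionalEquality
  open +-*-Solver

  private
    variable
      k : ℕ

  ℕ→ℚ-toℚᵘ : ∀ n → toℚᵘ (ℕ→ℚ n) ℚᵘ.≃ ℚᵘ.mkℚᵘ (ℤ.+ n) 0
  ℕ→ℚ-toℚᵘ n = ℚ.toℚᵘ-fromℚᵘ (ℚᵘ.mkℚᵘ (ℤ.+ n) 0)

  ℕ→ℚ-+ : ∀ m n → ℕ→ℚ (m ℕ.+ n) ≡ ℕ→ℚ m + ℕ→ℚ n
  ℕ→ℚ-+ m n = ℚ.toℚᵘ-injective (begin
    toℚᵘ (ℕ→ℚ (m ℕ.+ n))                      ≈⟨ ℕ→ℚ-toℚᵘ (m ℕ.+ n) ⟩
    ℚᵘ.mkℚᵘ (ℤ.+ (m ℕ.+ n)) 0                 ≈⟨ ℚᵘ.*≡* cross-multiplied ⟩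
    ℚᵘ.mkℚᵘ (ℤ.+ m) 0 ℚᵘ.+ ℚᵘ.mkℚᵘ (ℤ.+ n) 0  ≈⟨ ℚᵘ.+-cong (ℕ→ℚ-toℚᵘ m) (ℕ→ℚ-toℚᵘ n) ⟨
    toℚᵘ (ℕ→ℚ m) ℚᵘ.+ toℚᵘ (ℕ→ℚ n)            ≈⟨ ℚ.toℚᵘ-homo-+ (ℕ→ℚ m) (ℕ→ℚ n) ⟨
    toℚᵘ (ℕ→ℚ m + ℕ→ℚ n)                      ∎)
    where
    open ℚᵘ.≃-Reasoning
    cross-multiplied : ℤ.+ (m ℕ.+ n) ℤ.* ℤ.+ 1 ≡ (ℤ.+ m ℤ.* ℤ.+ 1 ℤ.+ ℤ.+ n ℤ.* ℤ.+ 1) ℤ.* ℤ.+ 1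
    cross-multiplied rewrite ℤ.*-identityʳ (ℤ.+ m) | ℤ.*-identityʳ (ℤ.+ n) = cong (ℤ._* ℤ.+ 1) (ℤ.pos-+ m n)

  ℕ→ℚ-* : ∀ m n → ℕ→ℚ (m ℕ.* n) ≡ ℕ→ℚ m * ℕ→ℚ n
  ℕ→ℚ-* m n = ℚ.toℚᵘ-injective (begin
    toℚᵘ (ℕ→ℚ (m ℕ.* n))                      ≈⟨ ℕ→ℚ-toℚᵘ (m ℕ.* n) ⟩
    ℚᵘ.mkℚᵘ (ℤ.+ (m ℕ.* n)) 0                 ≈⟨ ℚᵘ.*≡* (cong (ℤ._* ℤ.+ 1) (ℤ.pos-* m n)) ⟩
    ℚᵘ.mkℚᵘ (ℤ.+ m) 0 ℚᵘ.* ℚᵘ.mkℚᵘ (ℤ.+ n) 0  ≈⟨ ℚᵘ.*-cong (ℕ→ℚ-toℚᵘ m) (ℕ→ℚ-toℚᵘ n) ⟨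
    toℚᵘ (ℕ→ℚ m) ℚᵘ.* toℚᵘ (ℕ→ℚ n)            ≈⟨ ℚ.toℚᵘ-homo-* (ℕ→ℚ m) (ℕ→ℚ n) ⟨
    toℚᵘ (ℕ→ℚ m * ℕ→ℚ n)                      ∎)
    where open ℚᵘ.≃-Reasoning

  ℕ→ℚ-nonNeg : ∀ n → 0ℚ ≤ ℕ→ℚ n
  ℕ→ℚ-nonNeg n = ℚ.nonNegative⁻¹ (ℕ→ℚ n) {{ℚ.normalize-nonNeg n 1}}

  *-nonNeg : ∀ {p q} → 0ℚ ≤ p → 0ℚ ≤ q → 0ℚ ≤ p * q
  *-nonNeg {p} {q} 0≤p 0≤q =
    ℚ.nonNegative⁻¹ (p * q) {{ℚ.nonNeg*nonNeg⇒nonNeg p {{ℚ.nonNegative 0≤p}} q {{ℚ.nonNegative 0≤q}}}}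

  sum-single-support : ∀ {n} {i : Fin n} (t : Fin n → ℚ) → (∀ j → j ≢ i → t j ≡ 0ℚ) → Σℚ t ≡ t i
  sum-single-support {suc n} {i} t t≡0 = begin
    Σℚ t                                  ≡⟨ sum-remove t ⟩
    t i + Σℚ (λ j → t (punchIn i j))       ≡⟨ cong (t i +_) (sum-cong-≗ (λ j → t≡0 _ (punchInᵢ≢i i j))) ⟩
    t i + Σℚ {n} (λ _ → 0ℚ)               ≡⟨ cong (t i +_) (sum-replicate-zero n) ⟩
    t i + 0ℚ                              ≡⟨ ℚ.+-identityʳ (t i) ⟩
    t i                                   ∎
    where open ≡-Reasoning

  weightedMean-const : ∀ {α β : ℚ} q → α + β ≡ 1ℚ → α * q + β * q ≡ q
  weightedMean-const {α} {β} q α+β≡1 = begin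
    α * q + β * q ≡⟨ ℚ.*-distribʳ-+ q α β ⟨
    (α + β) * q   ≡⟨ cong (_* q) α+β≡1 ⟩
    1ℚ * q        ≡⟨ ℚ.*-identityˡ q ⟩
    q             ∎
    where open ≡-Reasoning

  weightedMean-∸-+ : ∀ {α β : ℚ} {x a b} → a ℕ.≤ x → α + β ≡ 1ℚ → α * ℕ→ℚ a ≡ β * ℕ→ℚ b →
                     α * ℕ→ℚ (x ∸ a) + β * ℕ→ℚ (x ℕ.+ b) ≡ ℕ→ℚ x
  weightedMean-∸-+ {α} {β} {x} {a} {b} a≤x α+β≡1 balanced = begin
    α * y + β * ℕ→ℚ (x ℕ.+ b)     ≡⟨ cong (λ t → α * y + β * t) (trans (ℕ→ℚ-+ x b) (cong (_+ B) x≡y+A)) ⟩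
    α * y + β * (y + A + B)       ≡⟨ solve 5 (λ α β y A B → α :* y :+ β :* (y :+ A :+ B)
                                               := (α :+ β) :* y :+ β :* A :+ β :* B) refl α β y A B ⟩
    (α + β) * y + β * A + β * B   ≡⟨ cong₂ (λ s t → s * y + β * A + t) α+β≡1 (sym balanced) ⟩
    1ℚ * y + β * A + α * A        ≡⟨ solve 4 (λ α β y A → con 1ℚ :* y :+ β :* A :+ α :* A
                                               := y :+ (α :+ β) :* A) refl α β y A ⟩
    y + (α + β) * A               ≡⟨ cong (λ s → y + s * A) α+β≡1 ⟩
    y + 1ℚ * A                    ≡⟨ cong (y +_) (ℚ.*-identityˡ A) ⟩
    y + A                         ≡⟨ x≡y+A ⟨
    ℕ→ℚ x                         ∎
    where
    open ≡-Reasoning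
    y A B : ℚ
    y = ℕ→ℚ (x ∸ a)
    A = ℕ→ℚ a
    B = ℕ→ℚ b
    x≡y+A : ℕ→ℚ x ≡ y + A
    x≡y+A = trans (cong ℕ→ℚ (sym (m∸n+n≡m a≤x))) (ℕ→ℚ-+ (x ∸ a) a)

  updateAt-weightedMean : ∀ {α β : ℚ} {h : Fin k → ℕ} {m a b} →
    a ℕ.≤ h m → α + β ≡ 1ℚ → α * ℕ→ℚ a ≡ β * ℕ→ℚ b →
    ∀ i → α * ℕ→ℚ (updateAt h m (λ _ → h m ∸ a) i) + β * ℕ→ℚ (updateAt h m (λ _ → h m ℕ.+ b) i)
          ≡ ℕ→ℚ (h i)
  updateAt-weightedMean {α = α} {β} {h} {m} {a} {b} a≤hm α+β≡1 balanced i with i ≟ m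
  ... | yes refl rewrite updateAt-updates i {λ _ → h i ∸ a} h | updateAt-updates i {λ _ → h i ℕ.+ b} h
    = weightedMean-∸-+ {α} {β} a≤hm α+β≡1 balanced
  ... | no i≢m rewrite updateAt-minimal i m {λ _ → h m ∸ a} h i≢m | updateAt-minimal i m {λ _ → h m ℕ.+ b} h i≢m
    = weightedMean-const {α} {β} (ℕ→ℚ (h i)) α+β≡1

  weightedMean-*ʳ : ∀ {α β : ℚ} x₁ x₂ x y → α * ℕ→ℚ x₁ + β * ℕ→ℚ x₂ ≡ ℕ→ℚ x →
                    α * ℕ→ℚ (x₁ ℕ.* y) + β * ℕ→ℚ (x₂ ℕ.* y) ≡ ℕ→ℚ (x ℕ.* y)
  weightedMean-*ʳ {α} {β} x₁ x₂ x y mean = begin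
    α * ℕ→ℚ (x₁ ℕ.* y) + β * ℕ→ℚ (x₂ ℕ.* y)
      ≡⟨ cong₂ (λ u v → α * u + β * v) (ℕ→ℚ-* x₁ y) (ℕ→ℚ-* x₂ y) ⟩
    α * (ℕ→ℚ x₁ * ℕ→ℚ y) + β * (ℕ→ℚ x₂ * ℕ→ℚ y)
      ≡⟨ solve 5 (λ α β x₁ x₂ y → α :* (x₁ :* y) :+ β :* (x₂ :* y) := (α :* x₁ :+ β :* x₂) :* y)
           refl α β (ℕ→ℚ x₁) (ℕ→ℚ x₂) (ℕ→ℚ y) ⟩
    (α * ℕ→ℚ x₁ + β * ℕ→ℚ x₂) * ℕ→ℚ y ≡⟨ cong (_* ℕ→ℚ y) mean ⟩
    ℕ→ℚ x * ℕ→ℚ y                     ≡⟨ ℕ→ℚ-* x y ⟨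
    ℕ→ℚ (x ℕ.* y)                     ∎
    where open ≡-Reasoning

  mean-of-products : ∀ {α β : ℚ} {h P₁ P₂ : Fin k → ℕ} (m : Fin k) →
    (∀ i → i ≢ m → P₁ i ≡ h i) → (∀ i → i ≢ m → P₂ i ≡ h i) →
    (∀ i → α * ℕ→ℚ (P₁ i) + β * ℕ→ℚ (P₂ i) ≡ ℕ→ℚ (h i)) →
    ∀ i j → i ≢ j → α * ℕ→ℚ (P₁ i ℕ.* P₁ j) + β * ℕ→ℚ (P₂ i ℕ.* P₂ j) ≡ ℕ→ℚ (h i ℕ.* h j)
  mean-of-products {α = α} {β} {h} {P₁} {P₂} m P₁≡h P₂≡h mean i j i≢j with j ≟ m
  ... | no j≢m rewrite P₁≡h j j≢m | P₂≡h j j≢m = weightedMean-*ʳ {α} {β} (P₁ i) (P₂ i) (h i) (h j) (mean i)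
  ... | yes refl rewrite *-comm (P₁ i) (P₁ j) | *-comm (P₂ i) (P₂ j) | *-comm (h i) (h j)
                       | P₁≡h i i≢j | P₂≡h i i≢j = weightedMean-*ʳ {α} {β} (P₁ j) (P₂ j) (h j) (h i) (mean j)

  record BalancingWeights (a b : ℕ) : Set where
    field
      α β      : ℚ
      0≤α      : 0ℚ ≤ α
      0≤β      : 0ℚ ≤ β
      α+β≡1    : α + β ≡ 1ℚ
      balanced : α * ℕ→ℚ a ≡ β * ℕ→ℚ b

  balancingWeights : ∀ a b → BalancingWeights a b
  balancingWeights zero b = record
    { α = 1ℚ ; β = 0ℚ ; 0≤α = ℚ.nonNegative⁻¹ 1ℚ ; 0≤β = ℚ.≤-refl
    ; α+β≡1 = refl ; balanced = sym (ℚ.*-zeroˡ (ℕ→ℚ b)) }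
  balancingWeights a@(suc _) b = record
    { α = B * r ; β = A * r
    ; 0≤α = *-nonNeg (ℕ→ℚ-nonNeg b) 0≤r ; 0≤β = *-nonNeg (ℕ→ℚ-nonNeg a) 0≤r
    ; α+β≡1 = begin
        B * r + A * r      ≡⟨ solve 3 (λ A B r → B :* r :+ A :* r := (A :+ B) :* r) refl A B r ⟩
        (A + B) * r        ≡⟨ cong (_* r) (ℕ→ℚ-+ a b) ⟨
        ℕ→ℚ (a ℕ.+ b) * r  ≡⟨ ℚ.*-inverseʳ (ℕ→ℚ (a ℕ.+ b)) ⟩
        1ℚ                 ∎
    ; balanced = solve 3 (λ A B r → B :* r :* A := A :* r :* B) refl A B r
    }
    where
    open ≡-Reasoning
    A B : ℚ
    A = ℕ→ℚ a
    B = ℕ→ℚ b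
    instance
      a+b>0 : ℚ.Positive (ℕ→ℚ (a ℕ.+ b))
      a+b>0 = ℚ.normalize-pos (a ℕ.+ b) 1
      a+b≢0 : ℚ.NonZero (ℕ→ℚ (a ℕ.+ b))
      a+b≢0 = ℚ.pos⇒nonZero (ℕ→ℚ (a ℕ.+ b))
    r : ℚ
    r = 1/ ℕ→ℚ (a ℕ.+ b)
    0≤r : 0ℚ ≤ r
    0≤r = ℚ.nonNegative⁻¹ r {{ℚ.pos⇒nonNeg r {{ℚ.1/pos⇒pos (ℕ→ℚ (a ℕ.+ b))}}}}

  Assignment : ℕ → Set
  Assignment k = Fin k → Fin k → Fin k → ℚ

  diagonal? : (i j l : Fin k) → Dec (i ≡ j × j ≡ l)
  diagonal? i j l = i ≟ j ×-dec j ≟ l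

  withDiagonal : (Fin k → ℚ) → Assignment k → Assignment k
  withDiagonal d O i j l with diagonal? i j l
  ... | yes _ = d i
  ... | no  _ = O i j l

  module WithDiagonal (d : Fin k → ℚ) (O : Assignment k) where

    withDiagonal-diag : ∀ i → withDiagonal d O i i i ≡ d i
    withDiagonal-diag i with diagonal? i i i
    ... | yes _ = refl
    ... | no ¬d = contradiction (refl , refl) ¬d

    withDiagonal-off : ∀ {i j l} → ¬ (i ≡ j × j ≡ l) → withDiagonal d O i j l ≡ O i j l
    withDiagonal-off {i} {j} {l} ¬d with diagonal? i j l
    ... | yes d = contradiction d ¬d
    ... | no  _ = refl

    withDiagonal-nonNeg : (∀ i → 0ℚ ≤ d i) → (∀ i j l → 0ℚ ≤ O i j l) →
                          ∀ i j l → 0ℚ ≤ withDiagonal d O i j l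
    withDiagonal-nonNeg 0≤d 0≤O i j l with diagonal? i j l
    ... | yes _ = 0≤d i
    ... | no  _ = 0≤O i j l

    withDiagonal-sym₁₂ : (∀ i j l → O i j l ≡ O j i l) →
                         ∀ i j l → withDiagonal d O i j l ≡ withDiagonal d O j i l
    withDiagonal-sym₁₂ O-sym i j l with diagonal? i j l | diagonal? j i l
    ... | yes (refl , _)    | yes _  = refl
    ... | yes (refl , refl) | no ¬d  = contradiction (refl , refl) ¬d
    ... | no ¬d             | yes (refl , refl) = contradiction (refl , refl) ¬d
    ... | no _              | no _   = O-sym i j l

    withDiagonal-sym₂₃ : (∀ i j l → O i j l ≡ O i l j) →
                         ∀ i j l → withDiagonal d O i j l ≡ withDiagonal d O i l j
    withDiagonal-sym₂₃ O-sym i j l with diagonal? i j l | diagonal? i l j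
    ... | yes _             | yes _  = refl
    ... | yes (refl , refl) | no ¬d  = contradiction (refl , refl) ¬d
    ... | no ¬d             | yes (refl , refl) = contradiction (refl , refl) ¬d
    ... | no _              | no _   = O-sym i j l

  mixture : ℚ → ℚ → Assignment k → Assignment k → Assignment k
  mixture α β O₁ O₂ i j l = α * O₁ i j l + β * O₂ i j l

  mixture-isROS : ∀ {α β : ℚ} {P₁ P₂ h : Fin k → ℕ} {O₁ O₂ : Assignment k} →
    IsROS P₁ O₁ → IsROS P₂ O₂ → 0ℚ ≤ α → 0ℚ ≤ β →
    (∀ i j → i ≢ j → α * ℕ→ℚ (P₁ i ℕ.* P₁ j) + β * ℕ→ℚ (P₂ i ℕ.* P₂ j) ≡ ℕ→ℚ (h i ℕ.* h j)) →
    IsROS h (withDiagonal (λ i → ℕ→ℚ (h i ℕ.* h i)) (mixture α β O₁ O₂))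
  mixture-isROS {α = α} {β} {P₁} {P₂} {h} {O₁} {O₂} R₁ R₂ 0≤α 0≤β cross = record
    { nonneg  = withDiagonal-nonNeg (λ i → ℕ→ℚ-nonNeg (h i ℕ.* h i)) λ i j l →
                  ℚ.+-mono-≤ (*-nonNeg 0≤α (R₁.nonneg i j l)) (*-nonNeg 0≤β (R₂.nonneg i j l))
    ; sym₁₂   = withDiagonal-sym₁₂ λ i j l → cong₂ combine (R₁.sym₁₂ i j l) (R₂.sym₁₂ i j l)
    ; sym₂₃   = withDiagonal-sym₂₃ λ i j l → cong₂ combine (R₁.sym₂₃ i j l) (R₂.sym₂₃ i j l)
    ; rowSum  = rowSum
    ; diag    = withDiagonal-diag
    ; offDiag = offDiag
    }
    where
    module R₁ = IsROS R₁
    module R₂ = IsROS R₂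
    open WithDiagonal (λ i → ℕ→ℚ (h i ℕ.* h i)) (mixture α β O₁ O₂)
    open ≡-Reasoning

    O : Assignment _
    O = withDiagonal (λ i → ℕ→ℚ (h i ℕ.* h i)) (mixture α β O₁ O₂)

    combine : ℚ → ℚ → ℚ
    combine x y = α * x + β * y

    offDiag : ∀ i j → i ≢ j → O i i j ≡ 0ℚ
    offDiag i j i≢j = begin
      O i i j                       ≡⟨ withDiagonal-off (i≢j ∘ proj₂) ⟩
      combine (O₁ i i j) (O₂ i i j) ≡⟨ cong₂ combine (R₁.offDiag i j i≢j) (R₂.offDiag i j i≢j) ⟩
      combine 0ℚ 0ℚ                 ≡⟨ solve 2 (λ α β → α :* con 0ℚ :+ β :* con 0ℚ := con 0ℚ) refl α β ⟩
      0ℚ                            ∎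

    rowSum : ∀ i j → Σℚ (O i j) ≡ ℕ→ℚ (h i ℕ.* h j)
    rowSum i j = row (i ≟ j)
      where
      row : Dec (i ≡ j) → Σℚ (O i j) ≡ ℕ→ℚ (h i ℕ.* h j)
      row (yes refl) = trans (sum-single-support (O i i) λ l l≢i → offDiag i l (l≢i ∘ sym)) (withDiagonal-diag i)
      row (no i≢j) = begin
        Σℚ (O i j)                                     ≡⟨ sum-cong-≗ (λ l → withDiagonal-off {l = l} (i≢j ∘ proj₁)) ⟩
        Σℚ (λ l → α * O₁ i j l + β * O₂ i j l)         ≡⟨ ∑-distrib-+ (λ l → α * O₁ i j l) (λ l → β * O₂ i j l) ⟩
        Σℚ (λ l → α * O₁ i j l) + Σℚ (λ l → β * O₂ i j l)
          ≡⟨ cong₂ _+_ (*-distribˡ-sum α (O₁ i j)) (*-distribˡ-sum β (O₂ i j)) ⟨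
        combine (Σℚ (O₁ i j)) (Σℚ (O₂ i j))            ≡⟨ cong₂ combine (R₁.rowSum i j) (R₂.rowSum i j) ⟩
        combine (ℕ→ℚ (P₁ i ℕ.* P₁ j)) (ℕ→ℚ (P₂ i ℕ.* P₂ j)) ≡⟨ cross i j i≢j ⟩
        ℕ→ℚ (h i ℕ.* h j)                              ∎

open import Data.Nat using (ℕ; _+_; _∸_; _≤_)
open import Data.Nat.Properties using (m∸n≢0⇒n<m; n>0⇒n≢0; <⇒≤)
open import Data.Vec.Functional.Properties using (updateAt-minimal)
open import Data.Product using (_,_)
open MixingROS

mainTheorem9 : (k : ℕ) (h : Fin k → ℕ) → Positive h →
    (m : Fin k) (a b : ℕ) → 1 ≤ h m ∸ a →
    HasROS (updateAt h m (λ _ → h m ∸ a)) → HasROS (updateAt h m (λ _ → h m + b)) → HasROS h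
mainTheorem9 k h _ m a b 1≤hm∸a (O₁ , R₁) (O₂ , R₂) =
  _ , mixture-isROS R₁ R₂ 0≤α 0≤β
        (mean-of-products {α = α} {β} {h} {P₁} {P₂} m
          (λ i → updateAt-minimal i m h) (λ i → updateAt-minimal i m h)
          (updateAt-weightedMean {α = α} {β} {h} {m} a≤hm α+β≡1 balanced))
  where
  open BalancingWeights (balancingWeights a b)
  P₁ P₂ : Fin k → ℕ
  P₁ = updateAt h m (λ _ → h m ∸ a)
  P₂ = updateAt h m (λ _ → h m + b)
  a≤hm : a ≤ h m
  a≤hm = <⇒≤ (m∸n≢0⇒n<m (n>0⇒n≢0 1≤hm∸a))
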